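{- For every $\varepsilon\in(0,1)$ and $m\in\mathbb{N}$ there exists $M_0$ such that for every $M\ge M_0$ the following holds. Suppose we have nonempty finite sets $\mathcal{P}^{rt}$ for $1\le r<t\le M$ and further sets $\mathcal{P}^{rt}_{s}\subseteq\mathcal{P}^{rt}$ with $|\mathcal{P}^{rt}_{s}|\ge\varepsilon|\mathcal{P}^{rt}|$ for $1\le r<s<t\le M$. Then there is a subset $Y\subseteq[M]$ of size $m$ and there are elements $P^{rt}\in\mathcal{P}^{rt}$ for all $r<t$ from $Y$ such that $P^{rt}\in\mathcal{P}^{rt}_{s}$ for every $s\in Y$ with $r<s<t$.
   Formalization: The parameter ε ranges over the rationals in (0,1) rather than the reals. -}

module Defs where

open import Data.Nat using (ℕ)
open import Data.Integer using (+_)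
open import Data.Rational using (ℚ; _/_)

ℕtoℚ : ℕ → ℚ
ℕtoℚ n = (+ n) / 1

{-# OPTIONS --safe #-}

-- Let q be the denominator of ε; then ε ≥ 1/q, so |𝒫ʳᵗₛ| ≥ |𝒫ʳᵗ|/q.
-- Fix r and candidates t₁ > t₂ > … above r.  By double counting, some P ∈ 𝒫^{r t₁} lies in at
-- least a 1/q fraction of the sets 𝒫^{r t₁}_s with s < t₁; take P^{r t₁} := P, discard the
-- candidates s with P ∉ 𝒫^{r t₁}_s and recurse.  Thus about q^k candidates yield k elements t,
-- each with a P^{rt} ∈ 𝒫^{rt}_s for all chosen s < t.
-- Y is built from the bottom: its least element r is the least candidate, the candidates above
-- r are thinned out as above, and the construction continues inside the thinned-out set.
module Submission where

open import Defs
open import Data.Nat using (ℕ)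
open import Data.Fin using (Fin)
open import Data.Fin.Subset using (Subset; _∈_; ∣_∣)
open import Data.Product using (Σ; _×_)
open import Relation.Binary.PropositionalEquality using (_≡_)
import Data.Nat as N
import Data.Fin as F
import Data.Rational as Q
import Data.Fin.Properties as FP

open import Data.Bool using (true; false; if_then_else_)
open import Data.Empty using (⊥-elim)
open import Data.Fin.Subset using (_∉_; ⁅_⁆; ⊥; inside; outside) renaming (_∪_ to _∪ˢ_)
open import Data.Fin.Subset.Properties using (_∈?_; ∉⊥; x∈p∪q⁻; x∈⁅y⁆⇒x≡y; ∣⊥∣≡0; ∪-identityˡ)
open import Data.Integer as Z using (+_; +[1+_])
import Data.Integer.Properties as ZP
open import Data.List using (List; []; _∷_; length; filter; reverse; allFin)
import Data.List.Properties as LP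
open import Data.List.Membership.Propositional using () renaming (_∈_ to _∈ˡ_)
open import Data.List.Membership.Propositional.Properties using (∈-filter⁻)
open import Data.List.Relation.Unary.All as All using (All; []; _∷_)
open import Data.List.Relation.Unary.AllPairs using (AllPairs; []; _∷_)
import Data.List.Relation.Unary.AllPairs.Properties as AllPairs
open import Data.List.Relation.Unary.Any using (here; there; toSum)
import Data.List.Relation.Unary.Any.Properties as Any
open import Data.Nat using (zero; suc; NonZero; _+_; _*_; _≤_; _<_; _≤?_; z≤n; s≤s)
open import Data.Nat.Properties
  using (+-*-semiring; +-identityʳ; *-identityʳ; *-comm; *-distribˡ-+; +-cancelˡ-≤; *-cancelˡ-≤;
         +-monoˡ-≤; +-mono-≤; m≤n*m; ≤-trans; ≤-reflexive; <⇒≤; ≰⇒>; module ≤-Reasoning)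
open import Data.Product using (∃; _,_; proj₁; proj₂)
import Data.Product as Product
open import Data.Sum using (_⊎_; inj₁; inj₂; [_,_])
import Data.Sum as Sum
import Data.Rational.Properties as QP
import Data.Rational.Unnormalised as U
import Data.Rational.Unnormalised.Properties as UP
open import Data.Vec.Base as Vec using ([]; _∷_)
open import Data.Vec.Functional using (Vector)
open import Function using (id; flip; _∘_)
open import Level using (Level; 0ℓ)
open import Relation.Binary using (Rel)
open import Relation.Binary.PropositionalEquality
  using (refl; sym; trans; cong; subst; subst₂; module ≡-Reasoning)
open import Relation.Nullary using (does; yes; no)
open import Relation.Unary using (Pred; Decidable; _⊆_; _∪_)

open import Algebra.Properties.Semiring.Sum +-*-semiring
  using (sum; ∑-distrib-+; *-distribˡ-sum; sum-cong-≗)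

private
  variable
    a ℓ : Level
    A : Set a
    n : ℕ

AllPairs-reverse⁺ : {R : Rel A ℓ} {xs : List A} → AllPairs R xs → AllPairs (flip R) (reverse xs)
AllPairs-reverse⁺ [] = []
AllPairs-reverse⁺ {xs = x ∷ xs} (Rx ∷ Rxs) rewrite LP.unfold-reverse x xs =
  AllPairs.++⁺ (AllPairs-reverse⁺ Rxs) ([] ∷ [])
    (All.tabulate λ y∈ → All.lookup Rx (Any.reverse⁻ y∈) ∷ [])

length-filter-∷ : {P : Pred A ℓ} (P? : Decidable P) (x : A) (xs : List A) →
  length (filter P? (x ∷ xs)) ≡ (if does (P? x) then 1 else 0) + length (filter P? xs)
length-filter-∷ P? x xs with does (P? x)
... | true  = refl
... | false = refl

∈⁅x⁆∪p⁻ : ∀ {y} (x : Fin n) (p : Subset n) → y ∈ ⁅ x ⁆ ∪ˢ p → y ≡ x ⊎ y ∈ p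
∈⁅x⁆∪p⁻ x p = Sum.map₁ (x∈⁅y⁆⇒x≡y x) ∘ x∈p∪q⁻ ⁅ x ⁆ p

∣⁅x⁆∪p∣≡1+∣p∣ : (x : Fin n) (p : Subset n) → x ∉ p → ∣ ⁅ x ⁆ ∪ˢ p ∣ ≡ suc ∣ p ∣
∣⁅x⁆∪p∣≡1+∣p∣ F.zero    (inside  ∷ p) x∉p = ⊥-elim (x∉p Vec.here)
∣⁅x⁆∪p∣≡1+∣p∣ F.zero    (outside ∷ p) _   = cong (suc ∘ ∣_∣) (∪-identityˡ p)
∣⁅x⁆∪p∣≡1+∣p∣ (F.suc x) (inside  ∷ p) x∉p = cong suc (∣⁅x⁆∪p∣≡1+∣p∣ x p (x∉p ∘ Vec.there))
∣⁅x⁆∪p∣≡1+∣p∣ (F.suc x) (outside ∷ p) x∉p = ∣⁅x⁆∪p∣≡1+∣p∣ x p (x∉p ∘ Vec.there)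

∑-pigeonhole : (f : Vector ℕ (suc n)) (b : ℕ) → suc n * b ≤ sum f → ∃ λ i → b ≤ f i
∑-pigeonhole {zero}  f b b≤f₀ = F.zero , subst₂ _≤_ (+-identityʳ b) (+-identityʳ (f F.zero)) b≤f₀
∑-pigeonhole {suc n} f b nb≤∑f with b ≤? f F.zero
... | yes b≤f₀ = F.zero , b≤f₀
... | no  b≰f₀ = Product.map F.suc id (∑-pigeonhole (f ∘ F.suc) b
      (+-cancelˡ-≤ b _ _ (≤-trans nb≤∑f (+-monoˡ-≤ _ (<⇒≤ (≰⇒> b≰f₀))))))

∑-indicator : (p : Subset n) → sum (λ x → if does (x ∈? p) then 1 else 0) ≡ ∣ p ∣
∑-indicator []            = refl
∑-indicator (inside  ∷ p) = cong suc (∑-indicator p)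
∑-indicator (outside ∷ p) = ∑-indicator p

degree : (A → Subset n) → List A → Fin n → ℕ
degree S xs x = length (filter (λ a → x ∈? S a) xs)

∑-degree-∷ : (S : A → Subset n) (a : A) (xs : List A) →
  sum (degree S (a ∷ xs)) ≡ ∣ S a ∣ + sum (degree S xs)
∑-degree-∷ S a xs = begin
  sum (degree S (a ∷ xs))
    ≡⟨ sum-cong-≗ (λ x → length-filter-∷ (λ b → x ∈? S b) a xs) ⟩
  sum (λ x → (if does (x ∈? S a) then 1 else 0) + degree S xs x)
    ≡⟨ ∑-distrib-+ _ (degree S xs) ⟩
  sum (λ x → if does (x ∈? S a) then 1 else 0) + sum (degree S xs)
    ≡⟨ cong (_+ _) (∑-indicator (S a)) ⟩
  ∣ S a ∣ + sum (degree S xs) ∎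
  where open ≡-Reasoning

double-counting : (q : ℕ) (S : A → Subset n) (xs : List A) → All (λ a → n ≤ q * ∣ S a ∣) xs →
  length xs * n ≤ q * sum (degree S xs)
double-counting q S []       []                 = z≤n
double-counting {n = n} q S (a ∷ xs) (n≤qSa ∷ dense) = begin
  n + length xs * n                    ≤⟨ +-mono-≤ n≤qSa (double-counting q S xs dense) ⟩
  q * ∣ S a ∣ + q * sum (degree S xs)  ≡⟨ *-distribˡ-+ q _ _ ⟨
  q * (∣ S a ∣ + sum (degree S xs))    ≡⟨ cong (q *_) (∑-degree-∷ S a xs) ⟨
  q * sum (degree S (a ∷ xs))          ∎
  where open ≤-Reasoning

popular-element : (q : ℕ) (S : A → Subset n) (xs : List A) → 0 < n → All (λ a → n ≤ q * ∣ S a ∣) xs →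
  ∃ λ x → length xs ≤ q * degree S xs x
popular-element {n = suc n} q S xs _ dense = ∑-pigeonhole (λ x → q * degree S xs x) (length xs) (begin
  suc n * length xs              ≡⟨ *-comm (suc n) (length xs) ⟩
  length xs * suc n              ≤⟨ double-counting q S xs dense ⟩
  q * sum (degree S xs)          ≡⟨ *-distribˡ-sum q (degree S xs) ⟩
  sum (λ x → q * degree S xs x)  ∎)
  where open ≤-Reasoning

toℚᵘ-ℕtoℚ : (n : ℕ) → Q.toℚᵘ (ℕtoℚ n) U.≃ U.mkℚᵘ (+ n) 0
toℚᵘ-ℕtoℚ n = QP.toℚᵘ-fromℚᵘ (U.mkℚᵘ (+ n) 0)

ε*n≤c⇒n≤↧ε*c : ∀ ε .{{_ : Q.Positive ε}} {n c} → ε Q.* ℕtoℚ n Q.≤ ℕtoℚ c → n ≤ Q.↧ₙ ε * c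
ε*n≤c⇒n≤↧ε*c ε@(Q.mkℚ +[1+ k ] d _) {n} {c} εn≤c = begin
  n            ≤⟨ m≤n*m n (suc k) ⟩
  suc k * n    ≤⟨ ZP.drop‿+≤+ cross-multiplied ⟩
  c * suc d    ≡⟨ *-comm c (suc d) ⟩
  suc d * c    ∎
  where
  open ≤-Reasoning
  εn≤c-ᵘ : U.mkℚᵘ +[1+ k ] d U.* U.mkℚᵘ (+ n) 0 U.≤ U.mkℚᵘ (+ c) 0
  εn≤c-ᵘ = UP.≤-respʳ-≃ (toℚᵘ-ℕtoℚ c) (UP.≤-respˡ-≃
    (UP.≃-trans (QP.toℚᵘ-homo-* ε (ℕtoℚ n)) (UP.*-congˡ {Q.toℚᵘ ε} (toℚᵘ-ℕtoℚ n)))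
    (QP.toℚᵘ-mono-≤ εn≤c))
  cross-multiplied : + (suc k * n) Z.≤ + (c * suc d)
  cross-multiplied = subst₂ Z._≤_
    (trans (ZP.*-identityʳ _) (sym (ZP.pos-* (suc k) n)))
    (trans (sym (ZP.pos-* c _)) (cong (λ e → + (c * suc e)) (*-identityʳ d)))
    (UP.drop-*≤* εn≤c-ᵘ)

admissibleFromBound : ℕ → ℕ → ℕ
admissibleFromBound q zero    = 0
admissibleFromBound q (suc k) = suc (q * admissibleFromBound q k)

admissibleBound : ℕ → ℕ → ℕ
admissibleBound q zero    = 0
admissibleBound q (suc j) = suc (admissibleFromBound q (admissibleBound q j))

module Selection {M : ℕ} (size : Fin M → Fin M → ℕ) (sub : (r s t : Fin M) → Subset (size r t))
  (q : ℕ) .{{_ : NonZero q}}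
  (nonempty : (r t : Fin M) → r F.< t → 0 < size r t)
  (dense : (r s t : Fin M) → r F.< s → s F.< t → size r t ≤ q * ∣ sub r s t ∣) where

  AdmissibleFrom : Fin M → Pred (Fin M) 0ℓ → Set
  AdmissibleFrom r U = ∀ {t} → U t →
    Σ (Fin (size r t)) λ x → ∀ {s} → U s → s F.< t → x ∈ sub r s t

  Admissible : Pred (Fin M) 0ℓ → Set
  Admissible U = ∀ {r t} → U r → U t → r F.< t →
    Σ (Fin (size r t)) λ x → ∀ {s} → U s → r F.< s → s F.< t → x ∈ sub r s t

  AdmissibleFrom-resp-⊆ : ∀ {r U V} → U ⊆ V → AdmissibleFrom r V → AdmissibleFrom r U
  AdmissibleFrom-resp-⊆ U⊆V adm t∈U = let (x , hx) = adm (U⊆V t∈U) in x , λ s∈U → hx (U⊆V s∈U)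

  Admissible-resp-⊆ : ∀ {U V} → U ⊆ V → Admissible V → Admissible U
  Admissible-resp-⊆ U⊆V adm r∈U t∈U r<t =
    let (x , hx) = adm (U⊆V r∈U) (U⊆V t∈U) r<t in x , λ s∈U → hx (U⊆V s∈U)

  AdmissibleFrom-insert : ∀ {r t U} → U ⊆ (F._< t) →
    (x : Fin (size r t)) → (∀ {s} → U s → x ∈ sub r s t) →
    AdmissibleFrom r U → AdmissibleFrom r ((_≡ t) ∪ U)
  AdmissibleFrom-insert U<t x hx adm (inj₁ refl) = x , λ
    { (inj₁ refl) t<t → ⊥-elim (FP.<-irrefl refl t<t)
    ; (inj₂ s∈U)  _   → hx s∈U }
  AdmissibleFrom-insert U<t x hx adm (inj₂ t′∈U) = let (x′ , hx′) = adm t′∈U in x′ , λ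
    { (inj₁ refl) t<t′ → ⊥-elim (FP.<-asym t<t′ (U<t t′∈U))
    ; (inj₂ s∈U)       → hx′ s∈U }

  Admissible-insert : ∀ {r U} → U ⊆ (r F.<_) →
    AdmissibleFrom r U → Admissible U → Admissible ((_≡ r) ∪ U)
  Admissible-insert r<U from adm (inj₁ refl) (inj₁ refl) r<r = ⊥-elim (FP.<-irrefl refl r<r)
  Admissible-insert r<U from adm (inj₁ refl) (inj₂ t∈U) _ = let (x , hx) = from t∈U in x , λ
    { (inj₁ refl) r<r _ → ⊥-elim (FP.<-irrefl refl r<r)
    ; (inj₂ s∈U)  _     → hx s∈U }
  Admissible-insert r<U from adm (inj₂ r′∈U) (inj₁ refl) r′<r = ⊥-elim (FP.<-asym r′<r (r<U r′∈U))
  Admissible-insert r<U from adm (inj₂ r′∈U) (inj₂ t∈U) r′<t = let (x , hx) = adm r′∈U t∈U r′<t in x , λ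
    { (inj₁ refl) r′<r _ → ⊥-elim (FP.<-asym r′<r (r<U r′∈U))
    ; (inj₂ s∈U)         → hx s∈U }

  record AdmissibleFromList (r : Fin M) (k : ℕ) (A : List (Fin M)) : Set where
    field
      list       : List (Fin M)
      ⊆A         : (_∈ˡ list) ⊆ (_∈ˡ A)
      decreasing : AllPairs F._>_ list
      length≡k   : length list ≡ k
      admissible : AdmissibleFrom r (_∈ˡ list)

  find-AdmissibleFromList : ∀ r k (A : List (Fin M)) → AllPairs F._>_ A → (_∈ˡ A) ⊆ (r F.<_) →
    admissibleFromBound q k ≤ length A → AdmissibleFromList r k A
  find-AdmissibleFromList r zero A _ _ _ = record
    { list = [] ; ⊆A = λ () ; decreasing = [] ; length≡k = refl ; admissible = λ () }
  find-AdmissibleFromList r (suc k) (t ∷ A) (A<t ∷ A↓) r<tA (s≤s bound) = record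
    { list       = t ∷ B.list
    ; ⊆A         = λ { (here t≡s) → here t≡s ; (there s∈B) → there (B⊆A s∈B) }
    ; decreasing = All.tabulate (All.lookup A<t ∘ B⊆A) ∷ B.decreasing
    ; length≡k   = cong suc B.length≡k
    ; admissible = AdmissibleFrom-resp-⊆ toSum
        (AdmissibleFrom-insert (All.lookup A<t ∘ B⊆A)
          x (proj₂ ∘ ∈-filter⁻ x∈? {xs = A} ∘ B.⊆A) B.admissible)
    }
    where
    r<t : r F.< t
    r<t = r<tA (here refl)
    popular : ∃ λ x → length A ≤ q * degree (λ s → sub r s t) A x
    popular = popular-element q (λ s → sub r s t) A (nonempty r t r<t)
      (All.tabulate λ s∈A → dense r _ t (r<tA (there s∈A)) (All.lookup A<t s∈A))
    x : Fin (size r t)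
    x = proj₁ popular
    x∈? : Decidable (λ s → x ∈ sub r s t)
    x∈? s = x ∈? sub r s t
    module B = AdmissibleFromList (find-AdmissibleFromList r k (filter x∈? A)
      (AllPairs.filter⁺ x∈? A↓) (r<tA ∘ there ∘ proj₁ ∘ ∈-filter⁻ x∈?)
      (*-cancelˡ-≤ q (≤-trans bound (proj₂ popular))))
    B⊆A : (_∈ˡ B.list) ⊆ (_∈ˡ A)
    B⊆A = proj₁ ∘ ∈-filter⁻ x∈? ∘ B.⊆A

  record AdmissibleSubset (j : ℕ) (A : List (Fin M)) : Set where
    field
      set        : Subset M
      ⊆A         : (_∈ set) ⊆ (_∈ˡ A)
      ∣set∣≡j    : ∣ set ∣ ≡ j
      admissible : Admissible (_∈ set)

  find-AdmissibleSubset : ∀ j (A : List (Fin M)) → AllPairs F._<_ A → admissibleBound q j ≤ length A →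
    AdmissibleSubset j A
  find-AdmissibleSubset zero A _ _ = record
    { set = ⊥ ; ⊆A = ⊥-elim ∘ ∉⊥ ; ∣set∣≡j = ∣⊥∣≡0 M ; admissible = ⊥-elim ∘ ∉⊥ }
  find-AdmissibleSubset (suc j) (r ∷ A) (r<A ∷ A↑) (s≤s bound) = record
    { set        = ⁅ r ⁆ ∪ˢ Y.set
    ; ⊆A         = [ (λ { refl → here refl }) , there ∘ Y⊆A ] ∘ ∈⁅x⁆∪p⁻ r Y.set
    ; ∣set∣≡j    = trans (∣⁅x⁆∪p∣≡1+∣p∣ r Y.set λ r∈Y → FP.<-irrefl refl (r<Y r∈Y)) (cong suc Y.∣set∣≡j)
    ; admissible = Admissible-resp-⊆ (∈⁅x⁆∪p⁻ r Y.set)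
        (Admissible-insert r<Y (AdmissibleFrom-resp-⊆ Y⊆B B.admissible) Y.admissible)
    }
    where
    module B = AdmissibleFromList (find-AdmissibleFromList r (admissibleBound q j) (reverse A)
      (AllPairs-reverse⁺ A↑) (All.lookup r<A ∘ Any.reverse⁻)
      (subst (_ ≤_) (sym (LP.length-reverse A)) bound))
    module Y = AdmissibleSubset (find-AdmissibleSubset j (reverse B.list)
      (AllPairs-reverse⁺ B.decreasing) (≤-reflexive (sym (trans (LP.length-reverse B.list) B.length≡k))))
    Y⊆B : (_∈ Y.set) ⊆ (_∈ˡ B.list)
    Y⊆B = Any.reverse⁻ ∘ Y.⊆A
    Y⊆A : (_∈ Y.set) ⊆ (_∈ˡ A)
    Y⊆A = Any.reverse⁻ ∘ B.⊆A ∘ Y⊆B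
    r<Y : (_∈ Y.set) ⊆ (r F.<_)
    r<Y = All.lookup r<A ∘ Y⊆A

corollary4p6 : (ε : Q.ℚ) → Q.0ℚ Q.< ε → ε Q.< Q.1ℚ → (m : ℕ) →
    Σ ℕ λ M₀ → (M : ℕ) → M₀ N.≤ M →
    (size : Fin M → Fin M → ℕ) →
    (sub : (r s t : Fin M) → Subset (size r t)) →
    ((r t : Fin M) → r F.< t → 1 N.≤ size r t) →
    ((r s t : Fin M) → r F.< s → s F.< t →
      ε Q.* ℕtoℚ (size r t) Q.≤ ℕtoℚ ∣ sub r s t ∣) →
    Σ (Subset M) λ Y → (∣ Y ∣ ≡ m) ×
      (Σ ((r t : Fin M) → r ∈ Y → t ∈ Y → r F.< t → Fin (size r t)) λ P →
        (r s t : Fin M) → (r∈Y : r ∈ Y) → s ∈ Y → (t∈Y : t ∈ Y) →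
          (r<s : r F.< s) → (s<t : s F.< t) →
          P r t r∈Y t∈Y (FP.<-trans r<s s<t) ∈ sub r s t)
corollary4p6 ε 0<ε _ m = admissibleBound (Q.↧ₙ ε) m , λ M M₀≤M size sub nonempty εdense →
  let open Selection size sub (Q.↧ₙ ε) nonempty
        (λ r s t r<s s<t → ε*n≤c⇒n≤↧ε*c ε {{Q.positive 0<ε}} (εdense r s t r<s s<t))
      open AdmissibleSubset (find-AdmissibleSubset m (allFin M) (AllPairs.tabulate⁺-< id)
        (subst (admissibleBound (Q.↧ₙ ε) m ≤_) (sym (LP.length-tabulate id)) M₀≤M))
  in set , ∣set∣≡j ,
     (λ r t r∈Y t∈Y r<t → proj₁ (admissible r∈Y t∈Y r<t)) ,
     λ r s t r∈Y s∈Y t∈Y r<s s<t → proj₂ (admissible r∈Y t∈Y (FP.<-trans r<s s<t)) s∈Y r<s s<t
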